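{- Let $N\ge 2$ be even and let $A_1,A_2,\ldots$ be a quasifibonacci sequence of level $N$. Then for every positive integer $n$, $f_n,g_n,h_n\in\{ -1,0,1\}$.
   Context: For an integer $N\ge 2$, a sequence $A_1,A_2,\ldots$ of positive integers is a quasifibonacci sequence of level $N$ if $A_{k+N}=A_{k+N-1}+\cdots+A_k$ for all $k\ge 1$, and $A_k>A_{k-1}+\cdots+A_1$ for all $1\le k\le N$. Let $\{0,1\}^{\omega}$ be the set of sequences $(a_1,a_2,\ldots)$ with $a_i\in\{0,1\}$ and $a_i=0$ for all but finitely many $i$. For $n\ge0$, $S_n=\{a\in\{0,1\}^{\omega}:\sum_{i}a_iA_i=n\}$. For nonzero $a$, $l(a)$ is the largest $i$ with $a_i=1$. For $A_k\le n<A_{k+1}$ let $T_n=\{a\in S_n: l(a)=k\}$ and $R_n=\{a\in S_n:l(a)=k-1\}$ (both empty if $n<A_1$). For $a\in\{0,1\}^\omega$ let $\sigma(a)=1$ if $a$ has an even number of $1$'s and $\sigma(a)=-1$ otherwise. Define $h_n=\sum_{a\in S_n}\sigma(a)$, $f_n=\sum_{a\in T_n}\sigma(a)$, $g_n=\sum_{a\in R_n}\sigma(a)$. (Thus $h_n$ is the coefficient of $x^n$ in $\prod_{k\ge1}(1-x^{A_k})$.) -}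

module Defs where

open import Data.Nat using (ℕ; zero; suc; _+_; _∸_; _≤_; _<_; _≡ᵇ_)
open import Data.Nat.Divisibility using (_∣_)
open import Data.Bool using (Bool; true; false; if_then_else_; _∧_)
open import Data.Integer using (ℤ; +_; -_)
import Data.Integer as ℤ
open import Data.List using (List; []; _∷_; map; _++_)
open import Data.Vec using (Vec; []; _∷_)
open import Data.Product using (_×_)
open import Data.Sum using (_⊎_)
open import Relation.Binary.PropositionalEquality using (_≡_)

-- A sequence A₁, A₂, … is represented as A : ℕ → ℕ with Aₖ = A k for k ≥ 1
-- (the value A 0 is irrelevant and never used).

sumFrom : (ℕ → ℕ) → ℕ → ℕ → ℕ
sumFrom A s zero      = 0
sumFrom A s (suc len) = A s + sumFrom A (suc s) len

record IsQuasiFib (N : ℕ) (A : ℕ → ℕ) : Set where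
  field
    positive   : ∀ k → 1 ≤ k → 1 ≤ A k
    recurrence : ∀ k → 1 ≤ k → A (k + N) ≡ sumFrom A k N
    initial    : ∀ k → 1 ≤ k → k ≤ N → sumFrom A 1 (k ∸ 1) < A k

-- A finitely supported 0/1 sequence (a₁, …, aₘ, 0, 0, …) is represented by the
-- vector (a₁, …, aₘ) : Vec Bool m (true = 1, false = 0).

allVecs : (m : ℕ) → List (Vec Bool m)
allVecs zero    = [] ∷ []
allVecs (suc m) = map (false ∷_) (allVecs m) ++ map (true ∷_) (allVecs m)

weightFrom : (ℕ → ℕ) → ℕ → {m : ℕ} → Vec Bool m → ℕ
weightFrom A off []       = 0
weightFrom A off (b ∷ bs) = (if b then A off else 0) + weightFrom A (suc off) bs

weight : (ℕ → ℕ) → {m : ℕ} → Vec Bool m → ℕ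
weight A = weightFrom A 1

-- l(a): largest index i with a_i = 1 (head has index `off`); 0 if a = 0
lastFrom : ℕ → {m : ℕ} → Vec Bool m → ℕ
lastFrom off []       = 0
lastFrom off (b ∷ bs) with lastFrom (suc off) bs
... | zero  = if b then off else 0
... | suc r = suc r

l : {m : ℕ} → Vec Bool m → ℕ
l = lastFrom 1

ones : {m : ℕ} → Vec Bool m → ℕ
ones []           = 0
ones (true ∷ bs)  = suc (ones bs)
ones (false ∷ bs) = ones bs

sign : ℕ → ℤ
sign zero    = + 1
sign (suc k) = - sign k

σ : {m : ℕ} → Vec Bool m → ℤ
σ a = sign (ones a)

signedSum : {m : ℕ} → (Vec Bool m → Bool) → List (Vec Bool m) → ℤ
signedSum P []       = + 0
signedSum P (a ∷ as) = (if P a then σ a else + 0) ℤ.+ signedSum P as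

-- h_n = Σ_{a ∈ S_n} σ(a).  Since A is strictly increasing with A_i ≥ i,
-- every a ∈ S_n (n ≥ 1) has a_i = 0 for i > n, so vectors of length n suffice.
h : (ℕ → ℕ) → ℕ → ℤ
h A n = signedSum (λ a → weight A a ≡ᵇ n) (allVecs n)

-- Σ_{a ∈ S_n, l(a) = k} σ(a).  For A_k ≤ n < A_{k+1}:
-- f_n = lsum A n k  and  g_n = lsum A n (k - 1).
lsum : (ℕ → ℕ) → ℕ → ℕ → ℤ
lsum A n k = signedSum (λ a → (weight A a ≡ᵇ n) ∧ (l a ≡ᵇ k)) (allVecs n)

In-101 : ℤ → Set
In-101 z = (z ≡ - (+ 1)) ⊎ (z ≡ + 0) ⊎ (z ≡ + 1)

module Submission where

-- All three are coefficients of the products p_j = ∏_{i = 1}^{j} (1 - x^(A i)):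
-- h_n is the coefficient of x^n in p_n, and the signed number of a ∈ S_n with
-- last index l(a) = k ≥ 1 is minus the coefficient of x^(n - A k) in p_(k-1)
-- (count-weight, count-last).  So it suffices to show that every coefficient
-- q j t of every p_j lies in {-1, 0, 1} (q-bounded), by strong induction on j.
-- Since p_(j+1) = p_j (1 - x^a) with a = A (j + 1), q (j+1) t = q j t - q j (t - a),
-- and only exponents a ≤ t ≤ a + P j (P = partial sums) need care.  For j < N the
-- initial condition P j < a rules them out.  For j = m + N we use that p_j is
-- palindromic up to the sign (-1)^j (coeff-reciprocal), that N is even, and that
-- the factors after the (m + 1)-st are invisible below A (m + 2): this folds the
-- new coefficient back to q m (u - A (m+1)) - q m (A (m+1) + u) (q-fold), and the
-- growth estimate P m < 2 A (m + 1) forces one of these two terms to vanish.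

open import Defs
open import Data.Nat as ℕ using (ℕ; zero; suc; _+_; _∸_; _≤_; _<_; _≡ᵇ_; z≤n; s≤s; _≤?_; _<?_)
import Data.Nat.Properties as ℕP
open import Data.Nat.Divisibility using (_∣_; divides)
open import Data.Bool using (Bool; true; false; if_then_else_; _∧_)
open import Data.Bool.Properties using (∧-zeroʳ)
open import Data.Integer as ℤ using (ℤ; +_; -_; -[1+_]; _-_; _*_)
import Data.Integer.Properties as ℤP
open import Data.Integer.Tactic.RingSolver using (solve-∀)
open import Data.List using (List; []; _∷_; map; _++_)
open import Data.Vec using (Vec; []; _∷_)
open import Data.Sum using (_⊎_; inj₁; inj₂)
open import Data.Empty using (⊥-elim)
open import Data.Product using (_×_; _,_; ∃-syntax)
open import Function.Bundles using (mk⇔)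
open import Relation.Nullary using (does; yes; no)
open import Relation.Nullary.Decidable using (does-⇔; dec-true; dec-false)
open import Data.Nat.Induction using (<-rec)
open import Relation.Binary.PropositionalEquality

+-minus : ∀ a x → + (a + x) - + a ≡ + x
+-minus a x = begin
  + (a + x) - + a    ≡⟨ ℤP.[+m]-[+n]≡m⊖n (a + x) a ⟩
  (a + x) ℤ.⊖ a      ≡⟨ ℤP.⊖-≥ (ℕP.m≤m+n a x) ⟩
  + (a + x ∸ a)      ≡⟨ cong +_ (ℕP.m+n∸m≡n a x) ⟩
  + x                ∎
  where open ≡-Reasoning

minus-> : ∀ {v a} → v < a → ∃[ k ] + v - + a ≡ -[1+ k ]
minus-> {v} {a} v<a with a ∸ v | ℤP.⊖-< v<a | ℕP.m<n⇒0<n∸m v<a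
... | suc k | v⊖a | _ = k , trans (ℤP.[+m]-[+n]≡m⊖n v a) v⊖a

negative-or-above : ∀ t a → (∃[ k ] t - + a ≡ -[1+ k ]) ⊎ (∃[ u ] t ≡ + (a + u))
negative-or-above -[1+ k ] a = inj₁ (a + k , ℤP.neg-minus-pos k a)
negative-or-above (+ n) a with n <? a
... | yes n<a = inj₁ (minus-> n<a)
... | no  n≮a = inj₂ (n ∸ a , cong +_ (sym (ℕP.m+[n∸m]≡n (ℕP.≮⇒≥ n≮a))))

minus-swap : ∀ t a b → t - a - b ≡ t - b - a
minus-swap = solve-∀

<-from-sum : ∀ {x y z w} → x + y ≡ z + w → z < y → x < w
<-from-sum {x} {y} {z} {w} eq z<y =
  ℕP.+-cancelˡ-< z x w (subst (z + x <_) (trans (ℕP.+-comm y x) eq) (ℕP.+-monoˡ-< x z<y))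

-- δ t is the coefficient of x^t in the constant polynomial 1.
δ : ℤ → ℤ
δ (+ zero) = + 1
δ _        = + 0

δ-negate : ∀ t → δ t ≡ δ (+ 0 - t)
δ-negate (+ zero)  = refl
δ-negate (+ suc n) = refl
δ-negate -[1+ n ]  = refl

In-101-δ : ∀ t → In-101 (δ t)
In-101-δ (+ zero)  = inj₂ (inj₂ refl)
In-101-δ (+ suc n) = inj₂ (inj₁ refl)
In-101-δ -[1+ n ]  = inj₂ (inj₁ refl)

In-101-neg : ∀ {z} → In-101 z → In-101 (- z)
In-101-neg (inj₁ refl)        = inj₂ (inj₂ refl)
In-101-neg (inj₂ (inj₁ refl)) = inj₂ (inj₁ refl)
In-101-neg (inj₂ (inj₂ refl)) = inj₁ refl

In-101-minus-0 : ∀ {x y} → In-101 x → y ≡ + 0 → In-101 (x - y)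
In-101-minus-0 {x} x∈ refl = subst In-101 (sym (ℤP.+-identityʳ x)) x∈

In-101-0-minus : ∀ {x y} → In-101 y → x ≡ + 0 → In-101 (x - y)
In-101-0-minus {y = y} y∈ refl = subst In-101 (sym (ℤP.+-identityˡ (- y))) (In-101-neg y∈)

sign-square : ∀ m → sign m * sign m ≡ + 1
sign-square zero    = refl
sign-square (suc m) = trans (neg*neg (sign m)) (sign-square m)
  where
  neg*neg : ∀ s → - s * - s ≡ s * s
  neg*neg = solve-∀

sign-consecutive : ∀ m x → sign m * (sign (suc m) * x) ≡ - x
sign-consecutive m x = begin
  sign m * (- sign m * x)    ≡⟨ regroup (sign m) x ⟩
  - (sign m * sign m * x)    ≡⟨ cong (λ s² → - (s² * x)) (sign-square m) ⟩
  - (+ 1 * x)                ≡⟨ cong (λ y → - y) (ℤP.*-identityˡ x) ⟩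
  - x                        ∎
  where
  open ≡-Reasoning
  regroup : ∀ s x → s * (- s * x) ≡ - (s * s * x)
  regroup = solve-∀

sign-+-even : ∀ m {p} → 2 ∣ p → sign (m + p) ≡ sign m
sign-+-even m (divides q refl) = sign-+-double m q
  where
  sign-+-double : ∀ m q → sign (m + q ℕ.* 2) ≡ sign m
  sign-+-double m zero    = cong sign (ℕP.+-identityʳ m)
  sign-+-double m (suc q) rewrite ℕP.+-suc m (suc (q ℕ.* 2)) | ℕP.+-suc m (q ℕ.* 2) =
    trans (ℤP.neg-involutive _) (sign-+-double m q)

module _ {m : ℕ} where

  signedSum-cong : {P Q : Vec Bool m → Bool} → (∀ a → P a ≡ Q a) →
                   (xs : List (Vec Bool m)) → signedSum P xs ≡ signedSum Q xs
  signedSum-cong P≡Q []       = refl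
  signedSum-cong {Q = Q} P≡Q (a ∷ xs) rewrite P≡Q a =
    cong (λ rest → (if Q a then σ a else + 0) ℤ.+ rest) (signedSum-cong P≡Q xs)

  signedSum-++ : (P : Vec Bool m → Bool) (xs ys : List (Vec Bool m)) →
                 signedSum P (xs ++ ys) ≡ signedSum P xs ℤ.+ signedSum P ys
  signedSum-++ P []       ys = sym (ℤP.+-identityˡ _)
  signedSum-++ P (a ∷ xs) ys rewrite signedSum-++ P xs ys =
    sym (ℤP.+-assoc (if P a then σ a else + 0) (signedSum P xs) (signedSum P ys))

  signedSum-none : {P : Vec Bool m → Bool} → (∀ a → P a ≡ false) →
                   (xs : List (Vec Bool m)) → signedSum P xs ≡ + 0
  signedSum-none P≡false []       = refl
  signedSum-none P≡false (a ∷ xs) rewrite P≡false a | signedSum-none P≡false xs = refl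

signedSum-false∷ : ∀ {m} (P : Vec Bool (suc m) → Bool) (xs : List (Vec Bool m)) →
                   signedSum P (map (false ∷_) xs) ≡ signedSum (λ a → P (false ∷ a)) xs
signedSum-false∷ P []       = refl
signedSum-false∷ P (a ∷ xs) =
  cong (λ rest → (if P (false ∷ a) then σ a else + 0) ℤ.+ rest) (signedSum-false∷ P xs)

signedSum-true∷ : ∀ {m} (P : Vec Bool (suc m) → Bool) (xs : List (Vec Bool m)) →
                  signedSum P (map (true ∷_) xs) ≡ - signedSum (λ a → P (true ∷ a)) xs
signedSum-true∷ P []       = refl
signedSum-true∷ P (a ∷ xs) rewrite signedSum-true∷ P xs with P (true ∷ a)
... | true  = sym (ℤP.neg-distrib-+ (σ a) (signedSum (λ b → P (true ∷ b)) xs))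
... | false = sym (ℤP.neg-distrib-+ (+ 0) (signedSum (λ b → P (true ∷ b)) xs))

signedSum-halves : ∀ {m} (P : Vec Bool (suc m) → Bool) {x y : ℤ} →
  signedSum (λ a → P (false ∷ a)) (allVecs m) ≡ x →
  signedSum (λ a → P (true ∷ a)) (allVecs m) ≡ y →
  signedSum P (allVecs (suc m)) ≡ x - y
signedSum-halves {m} P refl refl
  rewrite signedSum-++ P (map (false ∷_) (allVecs m)) (map (true ∷_) (allVecs m))
        | signedSum-false∷ P (allVecs m) | signedSum-true∷ P (allVecs m) = refl

lastFrom-false : ∀ off {m} (bs : Vec Bool m) → lastFrom off (false ∷ bs) ≡ lastFrom (suc off) bs
lastFrom-false off bs with lastFrom (suc off) bs
... | zero  = refl
... | suc r = refl

lastFrom-zero-or-≥ : ∀ off {m} (bs : Vec Bool m) → lastFrom off bs ≡ 0 ⊎ off ≤ lastFrom off bs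
lastFrom-zero-or-≥ off []       = inj₁ refl
lastFrom-zero-or-≥ off (b ∷ bs) with lastFrom (suc off) bs | lastFrom-zero-or-≥ (suc off) bs
lastFrom-zero-or-≥ off (true  ∷ bs) | zero  | _       = inj₂ ℕP.≤-refl
lastFrom-zero-or-≥ off (false ∷ bs) | zero  | _       = inj₁ refl
... | suc r | inj₂ ≥off = inj₂ (ℕP.≤-trans (ℕP.n≤1+n off) ≥off)

lastFrom-suc-≢ : ∀ off {m} (bs : Vec Bool m) → 1 ≤ off → (lastFrom (suc off) bs ≡ᵇ off) ≡ false
lastFrom-suc-≢ off bs 1≤off with lastFrom-zero-or-≥ (suc off) bs
... | inj₁ ≡0   = dec-false (_ ℕ.≟ off) λ ≡off → ℕP.<-irrefl (trans (sym ≡0) ≡off) 1≤off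
... | inj₂ >off = dec-false (_ ℕ.≟ off) λ ≡off → ℕP.<-irrefl (sym ≡off) >off

lastFrom-true-≢0 : ∀ off {m} (bs : Vec Bool m) → 1 ≤ off → (lastFrom off (true ∷ bs) ≡ᵇ 0) ≡ false
lastFrom-true-≢0 (suc off) bs _ with lastFrom (suc (suc off)) bs
... | zero  = refl
... | suc r = refl

lastFrom-true-here : ∀ off {m} (bs : Vec Bool m) → 1 ≤ off →
                     (lastFrom off (true ∷ bs) ≡ᵇ off) ≡ (lastFrom (suc off) bs ≡ᵇ 0)
lastFrom-true-here off bs 1≤off with lastFrom (suc off) bs | lastFrom-suc-≢ off bs 1≤off
... | zero  | _   = dec-true (off ℕ.≟ off) refl
... | suc r | ≢off = ≢off

lastFrom-true-later : ∀ off k {m} (bs : Vec Bool m) → off < k →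
                      (lastFrom off (true ∷ bs) ≡ᵇ k) ≡ (lastFrom (suc off) bs ≡ᵇ k)
lastFrom-true-later off k bs off<k with lastFrom (suc off) bs
... | zero  = trans (dec-false (off ℕ.≟ k) λ off≡k → ℕP.<-irrefl off≡k off<k)
                    (sym (dec-false (0 ℕ.≟ k) λ 0≡k → ℕP.<-irrefl 0≡k (ℕP.≤-<-trans z≤n off<k)))
... | suc r = refl

module Coefficients (A : ℕ → ℕ) where

  -- coeff off m t is the coefficient of x^t in  ∏_{i = off}^{off + m - 1} (1 - x^(A i)).
  coeff : ℕ → ℕ → ℤ → ℤ
  coeff off zero    t = δ t
  coeff off (suc m) t = coeff (suc off) m t - coeff (suc off) m (t - + A off)

  hits : ∀ {m} → ℕ → ℤ → Vec Bool m → Bool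
  hits off t a = does (+ weightFrom A off a ℤ.≟ t)

  hits-true∷ : ∀ off t {m} (a : Vec Bool m) → hits off t (true ∷ a) ≡ hits (suc off) (t - + A off) a
  hits-true∷ off t a = does-⇔ (mk⇔ to from) (+ (A off + w) ℤ.≟ t) (+ w ℤ.≟ t - + A off)
    where
    w = weightFrom A (suc off) a
    to : + (A off + w) ≡ t → + w ≡ t - + A off
    to refl = sym (+-minus (A off) w)
    from : + w ≡ t - + A off → + (A off + w) ≡ t
    from eq = begin
      + (A off + w)              ≡⟨ ℤP.pos-+ (A off) w ⟩
      + A off ℤ.+ + w            ≡⟨ cong (ℤ._+_ (+ A off)) eq ⟩
      + A off ℤ.+ (t - + A off)  ≡⟨ cancel (+ A off) t ⟩
      t                          ∎
      where
      open ≡-Reasoning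
      cancel : ∀ a t → a ℤ.+ (t - a) ≡ t
      cancel = solve-∀

  count-weight : ∀ off m t → signedSum (hits off t) (allVecs m) ≡ coeff off m t
  count-weight off zero    (+ zero)  = refl
  count-weight off zero    (+ suc n) = refl
  count-weight off zero    -[1+ n ]  = refl
  count-weight off (suc m) t = signedSum-halves {m} (hits off t)
    (count-weight (suc off) m t)
    (trans (signedSum-cong (hits-true∷ off t) (allVecs m)) (count-weight (suc off) m (t - + A off)))

  -- Only the zero vector has no 1 at all (last index 0), and its weight is 0.
  count-last-zero : ∀ off m t → 1 ≤ off →
    signedSum (λ a → hits off t a ∧ (lastFrom off a ≡ᵇ 0)) (allVecs m) ≡ δ t
  count-last-zero off zero    (+ zero)  _ = refl
  count-last-zero off zero    (+ suc n) _ = refl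
  count-last-zero off zero    -[1+ n ]  _ = refl
  count-last-zero off (suc m) t 1≤off =
    trans (signedSum-halves {m} (λ a → hits off t a ∧ (lastFrom off a ≡ᵇ 0)) zeroHead oneHead) (ℤP.+-identityʳ (δ t))
    where
    zeroHead : signedSum (λ a → hits (suc off) t a ∧ (lastFrom off (false ∷ a) ≡ᵇ 0)) (allVecs m) ≡ δ t
    zeroHead = trans (signedSum-cong (λ a → cong (λ i → hits (suc off) t a ∧ (i ≡ᵇ 0)) (lastFrom-false off a)) (allVecs m))
                     (count-last-zero (suc off) m t (s≤s z≤n))
    oneHead : signedSum (λ a → hits off t (true ∷ a) ∧ (lastFrom off (true ∷ a) ≡ᵇ 0)) (allVecs m) ≡ + 0
    oneHead = signedSum-none (λ a → trans (cong (hits off t (true ∷ a) ∧_) (lastFrom-true-≢0 off a 1≤off)) (∧-zeroʳ _)) (allVecs m)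

  -- The vectors whose last 1 sits at index off + d are a free prefix of length d
  -- followed by that 1; their signed count is minus a coefficient of the
  -- product of the first d factors.
  count-last : ∀ off d m t → 1 ≤ off → d < m →
    signedSum (λ a → hits off t a ∧ (lastFrom off a ≡ᵇ off + d)) (allVecs m) ≡ - coeff off d (t - + A (off + d))
  count-last off zero (suc m) t 1≤off _ rewrite ℕP.+-identityʳ off =
    trans (signedSum-halves {m} (λ a → hits off t a ∧ (lastFrom off a ≡ᵇ off)) zeroHead oneHead) (ℤP.+-identityˡ _)
    where
    zeroHead : signedSum (λ a → hits (suc off) t a ∧ (lastFrom off (false ∷ a) ≡ᵇ off)) (allVecs m) ≡ + 0
    zeroHead = signedSum-none (λ a → trans (cong (λ i → hits (suc off) t a ∧ (i ≡ᵇ off)) (lastFrom-false off a))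
                                           (trans (cong (hits (suc off) t a ∧_) (lastFrom-suc-≢ off a 1≤off)) (∧-zeroʳ _)))
                              (allVecs m)
    oneHead : signedSum (λ a → hits off t (true ∷ a) ∧ (lastFrom off (true ∷ a) ≡ᵇ off)) (allVecs m) ≡ δ (t - + A off)
    oneHead = trans (signedSum-cong (λ a → cong₂ _∧_ (hits-true∷ off t a) (lastFrom-true-here off a 1≤off)) (allVecs m))
                    (count-last-zero (suc off) m (t - + A off) (s≤s z≤n))
  count-last off (suc d) (suc m) t 1≤off (s≤s d<m) rewrite ℕP.+-suc off d =
    trans (signedSum-halves {m} (λ a → hits off t a ∧ (lastFrom off a ≡ᵇ k)) zeroHead oneHead)
          (trans (cong (λ i → - coeff (suc off) d (t - + A k) - - coeff (suc off) d i) (minus-swap t (+ A off) (+ A k)))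
                 (regroup (coeff (suc off) d (t - + A k)) (coeff (suc off) d (t - + A k - + A off))))
    where
    k = suc (off + d)
    zeroHead : signedSum (λ a → hits (suc off) t a ∧ (lastFrom off (false ∷ a) ≡ᵇ k)) (allVecs m)
               ≡ - coeff (suc off) d (t - + A k)
    zeroHead = trans (signedSum-cong (λ a → cong (λ i → hits (suc off) t a ∧ (i ≡ᵇ k)) (lastFrom-false off a)) (allVecs m))
                     (count-last (suc off) d m t (s≤s z≤n) d<m)
    oneHead : signedSum (λ a → hits off t (true ∷ a) ∧ (lastFrom off (true ∷ a) ≡ᵇ k)) (allVecs m)
              ≡ - coeff (suc off) d (t - + A off - + A k)
    oneHead = trans (signedSum-cong (λ a → cong₂ _∧_ (hits-true∷ off t a) (lastFrom-true-later off k a (s≤s (ℕP.m≤m+n off d)))) (allVecs m))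
                    (count-last (suc off) d m (t - + A off) (s≤s z≤n) d<m)
    regroup : ∀ x y → - x - - y ≡ - (x - y)
    regroup = solve-∀

  coeff-snoc : ∀ off m t → coeff off (suc m) t ≡ coeff off m t - coeff off m (t - + A (off + m))
  coeff-snoc off zero    t rewrite ℕP.+-identityʳ off = refl
  coeff-snoc off (suc m) t rewrite ℕP.+-suc off m = begin
    coeff (suc off) (suc m) t - coeff (suc off) (suc m) (t - a)
      ≡⟨ cong₂ _-_ (coeff-snoc (suc off) m t) (coeff-snoc (suc off) m (t - a)) ⟩
    (c t - c (t - b)) - (c (t - a) - c (t - a - b))
      ≡⟨ cong (λ i → (c t - c (t - b)) - (c (t - a) - c i)) (minus-swap t a b) ⟩
    (c t - c (t - b)) - (c (t - a) - c (t - b - a))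
      ≡⟨ exchange (c t) (c (t - b)) (c (t - a)) (c (t - b - a)) ⟩
    (c t - c (t - a)) - (c (t - b) - c (t - b - a))
      ∎
    where
    open ≡-Reasoning
    c = coeff (suc off) m
    a = + A off
    b = + A (suc (off + m))
    exchange : ∀ x y z w → (x - y) - (z - w) ≡ (x - z) - (y - w)
    exchange = solve-∀

  coeff-negative : ∀ off m k → coeff off m -[1+ k ] ≡ + 0
  coeff-negative off zero    k = refl
  coeff-negative off (suc m) k
    rewrite ℤP.neg-minus-pos k (A off) | coeff-negative (suc off) m k | coeff-negative (suc off) m (A off + k) = refl

  coeff-below : ∀ off m {v a} → v < a → coeff off m (+ v - + a) ≡ + 0
  coeff-below off m v<a with minus-> v<a
  ... | k , v-a = trans (cong (coeff off m) v-a) (coeff-negative off m k)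

  coeff-above : ∀ off m w → sumFrom A off m < w → coeff off m (+ w) ≡ + 0
  coeff-above off zero    (suc w) _   = refl
  coeff-above off (suc m) w       S<w =
    cong₂ _-_ (coeff-above (suc off) m w S′<w)
              (trans (cong (coeff (suc off) m) w-a) (coeff-above (suc off) m (w ∸ A off) S′<w-a))
    where
    S′ = sumFrom A (suc off) m
    S′<w : S′ < w
    S′<w = ℕP.≤-<-trans (ℕP.m≤n+m S′ (A off)) S<w
    w-a : + w - + A off ≡ + (w ∸ A off)
    w-a = trans (ℤP.[+m]-[+n]≡m⊖n w (A off)) (ℤP.⊖-≥ (ℕP.≤-trans (ℕP.m≤m+n (A off) S′) (ℕP.<⇒≤ S<w)))
    S′<w-a : S′ < w ∸ A off
    S′<w-a = ℕP.m+n≤o⇒m≤o∸n (suc S′) (subst (_≤ w) (cong suc (ℕP.+-comm (A off) S′)) S<w)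

  coeff-reciprocal : ∀ off m t → coeff off m t ≡ sign m * coeff off m (+ sumFrom A off m - t)
  coeff-reciprocal off zero    t = trans (δ-negate t) (sym (ℤP.*-identityˡ _))
  coeff-reciprocal off (suc m) t = begin
    c t - c (t - a)
      ≡⟨ cong₂ _-_ (coeff-reciprocal (suc off) m t) (coeff-reciprocal (suc off) m (t - a)) ⟩
    s * c (S′ - t) - s * c (S′ - (t - a))
      ≡⟨ cong₂ (λ i j → s * c i - s * c j) (shift₁ a S′ t) (shift₂ a S′ t) ⟩
    s * c (a ℤ.+ S′ - t - a) - s * c (a ℤ.+ S′ - t)
      ≡⟨ factor s (c (a ℤ.+ S′ - t)) (c (a ℤ.+ S′ - t - a)) ⟩
    - s * (c (a ℤ.+ S′ - t) - c (a ℤ.+ S′ - t - a))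
      ≡⟨ cong (λ i → - s * (c (i - t) - c (i - t - a))) (sym (ℤP.pos-+ (A off) (sumFrom A (suc off) m))) ⟩
    sign (suc m) * coeff off (suc m) (+ sumFrom A off (suc m) - t)
      ∎
    where
    open ≡-Reasoning
    c = coeff (suc off) m
    s = sign m
    a = + A off
    S′ = + sumFrom A (suc off) m
    shift₁ : ∀ a S t → S - t ≡ a ℤ.+ S - t - a
    shift₁ = solve-∀
    shift₂ : ∀ a S t → S - (t - a) ≡ a ℤ.+ S - t
    shift₂ = solve-∀
    factor : ∀ s x y → s * y - s * x ≡ - s * (x - y)
    factor = solve-∀

  coeff-reciprocal-ℕ : ∀ off m {u v} → u + v ≡ sumFrom A off m → coeff off m (+ u) ≡ sign m * coeff off m (+ v)
  coeff-reciprocal-ℕ off m {u} {v} u+v≡S =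
    trans (coeff-reciprocal off m (+ u))
          (cong (λ i → sign m * coeff off m i) (trans (cong (λ S → + S - + u) (sym u+v≡S)) (+-minus u v)))

sumFrom-+ : ∀ (A : ℕ → ℕ) s a b → sumFrom A s (a + b) ≡ sumFrom A s a + sumFrom A (s + a) b
sumFrom-+ A s zero    b rewrite ℕP.+-identityʳ s = refl
sumFrom-+ A s (suc a) b rewrite sumFrom-+ A (suc s) a b | ℕP.+-suc s a = sym (ℕP.+-assoc (A s) _ _)

sumFrom-snoc : ∀ (A : ℕ → ℕ) s n → sumFrom A s (suc n) ≡ sumFrom A s n + A (s + n)
sumFrom-snoc A s n = begin
  sumFrom A s (suc n)                        ≡⟨ cong (sumFrom A s) (ℕP.+-comm 1 n) ⟩
  sumFrom A s (n + 1)                        ≡⟨ sumFrom-+ A s n 1 ⟩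
  sumFrom A s n + (A (s + n) + 0)            ≡⟨ cong (_+_ (sumFrom A s n)) (ℕP.+-identityʳ _) ⟩
  sumFrom A s n + A (s + n)                  ∎
  where open ≡-Reasoning

first+last≤sumFrom : ∀ (A : ℕ → ℕ) s n → A s + A (s + suc n) ≤ sumFrom A s (suc (suc n))
first+last≤sumFrom A s n rewrite sumFrom-snoc A (suc s) n | ℕP.+-suc s n =
  ℕP.+-monoʳ-≤ (A s) (ℕP.m≤n+m _ _)

module QuasiFibonacci (n₂ : ℕ) (A : ℕ → ℕ) (qf : IsQuasiFib (suc (suc n₂)) A) where
  open IsQuasiFib qf

  N : ℕ
  N = suc (suc n₂)

  P : ℕ → ℕ
  P = sumFrom A 1

  P-suc : ∀ m → P (suc m) ≡ P m + A (suc m)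
  P-suc = sumFrom-snoc A 1

  P-period : ∀ c → P (c + N) ≡ P c + A (suc (c + N))
  P-period c = trans (sumFrom-+ A 1 c N) (cong (_+_ (P c)) (sym (recurrence (suc c) (s≤s z≤n))))

  beyond : ∀ {i} → N ≤ i → ∃[ c ] i ≡ c + N
  beyond {i} N≤i = i ∸ N , sym (ℕP.m∸n+n≡m N≤i)

  c+2≤c+N : ∀ c → suc (suc c) ≤ c + N
  c+2≤c+N c = ℕP.≤-trans (ℕP.≤-reflexive (ℕP.+-comm 2 c)) (ℕP.+-monoʳ-≤ c (s≤s (s≤s z≤n)))

  A≤P : ∀ i → 1 ≤ i → A i ≤ P i
  A≤P (suc i) _ = subst (A (suc i) ≤_) (sym (P-suc i)) (ℕP.m≤n+m _ _)

  -- A is strictly increasing: below N by the initial condition, beyond N since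
  -- A (c + N + 1) = A (c + 1) + ⋯ + A (c + N) contains A (c + N) and a positive term.
  A-increasing : ∀ i → 1 ≤ i → A i < A (suc i)
  A-increasing i 1≤i with suc i ≤? N
  ... | yes i+1≤N = ℕP.≤-<-trans (A≤P i 1≤i) (initial (suc i) (s≤s z≤n) i+1≤N)
  ... | no  i+1≰N with beyond (ℕP.≤-pred (ℕP.≰⇒> i+1≰N))
  ...   | c , refl = ℕP.<-≤-trans last<first+last first+last≤next
    where
    last<first+last : A (c + N) < A (suc c) + A (c + N)
    last<first+last = ℕP.+-monoˡ-< _ (positive (suc c) (s≤s z≤n))
    first+last≤next : A (suc c) + A (c + N) ≤ A (suc c + N)
    first+last≤next = subst₂ (λ i S → A (suc c) + A i ≤ S) (sym (ℕP.+-suc c (suc n₂)))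
                             (sym (recurrence (suc c) (s≤s z≤n))) (first+last≤sumFrom A (suc c) n₂)

  A-mono : ∀ {i} j → 1 ≤ i → i ≤ j → A i ≤ A j
  A-mono zero    (s≤s _) ()
  A-mono (suc j) 1≤i i≤j+1 with ℕP.m≤n⇒m<n∨m≡n i≤j+1
  ... | inj₂ refl      = ℕP.≤-refl
  ... | inj₁ (s≤s i≤j) = ℕP.≤-trans (A-mono j 1≤i i≤j) (ℕP.<⇒≤ (A-increasing j (ℕP.≤-trans 1≤i i≤j)))

  -- A k ≥ k; used to see that the relevant last indices satisfy k ≤ n.
  index≤A : ∀ k → 1 ≤ k → k ≤ A k
  index≤A (suc zero)    1≤k = positive 1 1≤k
  index≤A (suc (suc k)) _   = ℕP.≤-<-trans (index≤A (suc k) (s≤s z≤n)) (A-increasing (suc k) (s≤s z≤n))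

  -- Below level N this is the initial condition; beyond it, the recurrence
  -- gives P m + A (m + 1) = P c + A (m + 2) with m + 1 = c + N, and P c < A (c + 2) ≤ A (m + 1).
  P<A-next-next : ∀ m → P m < A (suc (suc m))
  P<A-next-next = <-rec (λ m → P m < A (suc (suc m))) bound
    where
    bound : ∀ m → (∀ {c} → c < m → P c < A (suc (suc c))) → P m < A (suc (suc m))
    bound m ih with suc (suc m) ≤? N
    ... | yes m+2≤N = ℕP.≤-<-trans (subst (P m ≤_) (sym (P-suc m)) (ℕP.m≤m+n _ _))
                                   (initial (suc (suc m)) (s≤s z≤n) m+2≤N)
    ... | no  m+2≰N with beyond (ℕP.≤-pred (ℕP.≰⇒> m+2≰N))
    ...   | c , m+1≡c+N = <-from-sum sums (ℕP.<-≤-trans (ih c<m) (A-mono (suc m) (s≤s z≤n) c+2≤m+1))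
      where
      c+2≤m+1 : suc (suc c) ≤ suc m
      c+2≤m+1 = subst (suc (suc c) ≤_) (sym m+1≡c+N) (c+2≤c+N c)
      c<m : c < m
      c<m = ℕP.≤-pred c+2≤m+1
      sums : P m + A (suc m) ≡ P c + A (suc (suc m))
      sums = begin
        P m + A (suc m)            ≡⟨ sym (P-suc m) ⟩
        P (suc m)                  ≡⟨ cong P m+1≡c+N ⟩
        P (c + N)                  ≡⟨ P-period c ⟩
        P c + A (suc (c + N))      ≡⟨ cong (λ i → P c + A (suc i)) (sym m+1≡c+N) ⟩
        P c + A (suc (suc m))      ∎
        where open ≡-Reasoning

  P<2A-next : ∀ m → P m < A (suc m) + A (suc m)
  P<2A-next zero    = ℕP.<-≤-trans (positive 1 (s≤s z≤n)) (ℕP.m≤m+n _ _)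
  P<2A-next (suc m) rewrite P-suc m =
    ℕP.+-mono-<-≤ (P<A-next-next m) (ℕP.<⇒≤ (A-increasing (suc m) (s≤s z≤n)))

  open Coefficients A

  q : ℕ → ℤ → ℤ
  q = coeff 1

  q-stable : ∀ i j v → v < A (suc j) → q (i + j) (+ v) ≡ q j (+ v)
  q-stable zero    j v _   = refl
  q-stable (suc i) j v v<A = begin
    q (suc (i + j)) (+ v)                                 ≡⟨ coeff-snoc 1 (i + j) (+ v) ⟩
    q (i + j) (+ v) - q (i + j) (+ v - + A (suc (i + j)))  ≡⟨ cong₂ _-_ (q-stable i j v v<A) (coeff-below 1 (i + j) v<A′) ⟩
    q j (+ v) - + 0                                       ≡⟨ ℤP.+-identityʳ (q j (+ v)) ⟩
    q j (+ v)                                             ∎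
    where
    open ≡-Reasoning
    v<A′ : v < A (suc (i + j))
    v<A′ = ℕP.<-≤-trans v<A (A-mono (suc (i + j)) (s≤s z≤n) (s≤s (ℕP.m≤n+m j i)))

  q-stable-N : ∀ m w → w < A (suc (suc m)) → q (m + N) (+ w) ≡ q (suc m) (+ w)
  q-stable-N m w w<A = trans (cong (λ j → q j (+ w)) m+N≡) (q-stable (suc n₂) (suc m) w w<A)
    where
    m+N≡ : m + N ≡ suc n₂ + suc m
    m+N≡ = trans (ℕP.+-comm m N) (cong suc (sym (ℕP.+-suc n₂ m)))

  module _ (N-even : 2 ∣ N) where

    -- For u ≤ P m,
    --   q (m + N) (A (m + N + 1) + u) = q m u - q m (A (m + 1) + u):
    -- reflect by palindromy, drop the invisible factors, reflect back.
    q-fold : ∀ m u → u ≤ P m → q (m + N) (+ (A (suc (m + N)) + u)) ≡ q m (+ u) - q m (+ (A (suc m) + u))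
    q-fold m u u≤P = begin
      q (m + N) (+ (a + u))
        ≡⟨ coeff-reciprocal-ℕ 1 (m + N) outer ⟩
      sign (m + N) * q (m + N) (+ v)
        ≡⟨ cong₂ _*_ (sign-+-even m N-even) (q-stable-N m v v<A) ⟩
      sign m * q (suc m) (+ v)
        ≡⟨ cong (sign m *_) (coeff-reciprocal-ℕ 1 (suc m) inner) ⟩
      sign m * (- sign m * q (suc m) (+ (b + u)))
        ≡⟨ sign-consecutive m (q (suc m) (+ (b + u))) ⟩
      - q (suc m) (+ (b + u))
        ≡⟨ cong (λ i → - i) (coeff-snoc 1 m (+ (b + u))) ⟩
      - (q m (+ (b + u)) - q m (+ (b + u) - + b))
        ≡⟨ cong (λ i → - (q m (+ (b + u)) - q m i)) (+-minus b u) ⟩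
      - (q m (+ (b + u)) - q m (+ u))
        ≡⟨ neg-minus (q m (+ (b + u))) (q m (+ u)) ⟩
      q m (+ u) - q m (+ (b + u))
        ∎
      where
      open ≡-Reasoning
      a = A (suc (m + N))
      b = A (suc m)
      v = P m ∸ u
      u+v : u + v ≡ P m
      u+v = ℕP.m+[n∸m]≡n u≤P
      v<A : v < A (suc (suc m))
      v<A = ℕP.≤-<-trans (ℕP.m∸n≤m (P m) u) (P<A-next-next m)
      outer : a + u + v ≡ P (m + N)
      outer = begin
        a + u + v      ≡⟨ ℕP.+-assoc a u v ⟩
        a + (u + v)    ≡⟨ cong (_+_ a) u+v ⟩
        a + P m        ≡⟨ ℕP.+-comm a (P m) ⟩
        P m + a        ≡⟨ sym (P-period m) ⟩
        P (m + N)      ∎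
      inner : v + (b + u) ≡ P (suc m)
      inner = begin
        v + (b + u)    ≡⟨ ℕP.+-comm v (b + u) ⟩
        b + u + v      ≡⟨ ℕP.+-assoc b u v ⟩
        b + (u + v)    ≡⟨ cong (_+_ b) u+v ⟩
        b + P m        ≡⟨ ℕP.+-comm b (P m) ⟩
        P m + b        ≡⟨ sym (P-suc m) ⟩
        P (suc m)      ∎
      neg-minus : ∀ x y → - (x - y) ≡ y - x
      neg-minus = solve-∀

    -- Hence the new coefficient at exponent A (m + N + 1) + u is a difference
    -- q m (u - A (m + 1)) - q m (A (m + 1) + u) of old coefficients, at most one
    -- of which is nonzero: the first needs u ≥ A (m + 1), the second
    -- A (m + 1) + u ≤ P m < 2 A (m + 1).
    q-fold-bounded : ∀ m u → (∀ t → In-101 (q m t)) → u ≤ P m →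
                     In-101 (q (m + N) (+ (A (suc (m + N)) + u)) - q (m + N) (+ u))
    q-fold-bounded m u q-m∈ u≤P = subst In-101 (sym difference) one-vanishes
      where
      b = A (suc m)
      u<A : u < A (suc (suc m))
      u<A = ℕP.≤-<-trans u≤P (P<A-next-next m)
      difference : q (m + N) (+ (A (suc (m + N)) + u)) - q (m + N) (+ u) ≡ q m (+ u - + b) - q m (+ (b + u))
      difference = begin
        q (m + N) (+ (A (suc (m + N)) + u)) - q (m + N) (+ u)
          ≡⟨ cong₂ _-_ (q-fold m u u≤P) (trans (q-stable-N m u u<A) (coeff-snoc 1 m (+ u))) ⟩
        (q m (+ u) - q m (+ (b + u))) - (q m (+ u) - q m (+ u - + b))
          ≡⟨ cancel (q m (+ u)) (q m (+ (b + u))) (q m (+ u - + b)) ⟩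
        q m (+ u - + b) - q m (+ (b + u))
          ∎
        where
        open ≡-Reasoning
        cancel : ∀ x y z → (x - y) - (x - z) ≡ z - y
        cancel = solve-∀
      one-vanishes : In-101 (q m (+ u - + b) - q m (+ (b + u)))
      one-vanishes with u <? b
      ... | yes u<b = In-101-0-minus (q-m∈ _) (coeff-below 1 m u<b)
      ... | no  u≮b = In-101-minus-0 (q-m∈ _) (coeff-above 1 m (b + u) P<b+u)
        where
        P<b+u : P m < b + u
        P<b+u = ℕP.<-≤-trans (P<2A-next m) (ℕP.+-monoʳ-≤ b (ℕP.≮⇒≥ u≮b))

    -- Only t = a + u with a + u ≤ P j
    -- needs care; then j ≥ N by the initial condition, and q-fold-bounded applies.
    q-suc-bounded : ∀ j → (∀ {i} → i ≤ j → ∀ t → In-101 (q i t)) → ∀ t → In-101 (q j t - q j (t - + A (suc j)))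
    q-suc-bounded j ih t with negative-or-above t (A (suc j))
    ... | inj₁ (k , t-a) = In-101-minus-0 (ih ℕP.≤-refl t) (trans (cong (q j) t-a) (coeff-negative 1 j k))
    ... | inj₂ (u , refl) with A (suc j) + u ≤? P j
    ...   | no  a+u≰P = In-101-0-minus (ih ℕP.≤-refl _) (coeff-above 1 j _ (ℕP.≰⇒> a+u≰P))
    ...   | yes a+u≤P with N ≤? j
    ...     | no  N≰j = ⊥-elim (ℕP.<-irrefl refl (ℕP.<-≤-trans P<a (ℕP.≤-trans (ℕP.m≤m+n _ u) a+u≤P)))
      where
      P<a : P j < A (suc j)
      P<a = initial (suc j) (s≤s z≤n) (ℕP.≰⇒> N≰j)
    ...     | yes N≤j with beyond N≤j
    ...       | m , refl = subst (λ i → In-101 (q (m + N) (+ (a + u)) - q (m + N) i)) (sym (+-minus a u))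
                                 (q-fold-bounded m u (ih (ℕP.m≤m+n m N)) u≤P)
      where
      a = A (suc (m + N))
      u≤P : u ≤ P m
      u≤P = ℕP.+-cancelˡ-≤ a u (P m) (subst (a + u ≤_) (trans (P-period m) (ℕP.+-comm (P m) a)) a+u≤P)

    q-bounded : ∀ j t → In-101 (q j t)
    q-bounded = <-rec (λ j → ∀ t → In-101 (q j t)) step
      where
      step : ∀ j → (∀ {i} → i < j → ∀ t → In-101 (q i t)) → ∀ t → In-101 (q j t)
      step zero    _  t = In-101-δ t
      step (suc j) ih t = subst In-101 (sym (coeff-snoc 1 j t)) (q-suc-bounded j (λ i≤j → ih (s≤s i≤j)) t)

proposition5p3 : (N : ℕ) → 2 ≤ N → 2 ∣ N → (A : ℕ → ℕ) → IsQuasiFib N A →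
    (n : ℕ) → 1 ≤ n →
      In-101 (h A n) ×
      ((k : ℕ) → 1 ≤ k → A k ≤ n → n < A (suc k) →
        In-101 (lsum A n k) × In-101 (lsum A n (k ∸ 1)))
proposition5p3 .(suc (suc n₂)) (s≤s (s≤s {n = n₂} _)) N-even A qf n _ = h-bound , f-g-bound
  where
  open QuasiFibonacci n₂ A qf
  open Coefficients A

  h-bound : In-101 (h A n)
  h-bound = subst In-101 (sym (count-weight 1 n (+ n))) (q-bounded N-even n (+ n))

  lsum-bound : ∀ k → k ≤ n → In-101 (lsum A n k)
  lsum-bound zero    _   = subst In-101 (sym (count-last-zero 1 n (+ n) ℕP.≤-refl)) (In-101-δ (+ n))
  lsum-bound (suc d) d<n = subst In-101 (sym (count-last 1 d n (+ n) ℕP.≤-refl d<n))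
                                 (In-101-neg (q-bounded N-even d _))

  f-g-bound : (k : ℕ) → 1 ≤ k → A k ≤ n → n < A (suc k) → In-101 (lsum A n k) × In-101 (lsum A n (k ∸ 1))
  f-g-bound k 1≤k Aₖ≤n _ = lsum-bound k k≤n , lsum-bound (k ∸ 1) (ℕP.≤-trans (ℕP.m∸n≤m k 1) k≤n)
    where
    k≤n : k ≤ n
    k≤n = ℕP.≤-trans (index≤A k 1≤k) Aₖ≤n
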